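{- Let $p$ be a prime and let $f\in\mathbb{Z}[x]$ be a primitive polynomial of the shape $$f(x)=(x^p-x)q(x)+p\,r(x),$$ with $r\in\mathbb{Z}[x]$ and $q(x)=\sum_{j=0}^{e}a_jx^j$, where $e\ge0$, the $a_j$ are integers with $0\le a_j<p$, and $a_e\ne0$. Then for each integer $0\le k<p$ there exists $\nu_k\in\mathbb{Z}$ such that: (1) $0\le\nu_k\le e$; (2) $f_k(x):=p^{ -\nu_k-1}f(px+k)$ lies in $\mathbb{Z}[x]$ and is primitive; (3) if $f_k$ has $p$ as a fixed prime divisor and is written as $f_k(x)=(x^p-x)q_k(x)+p\,r_k(x)$ with $r_k\in\mathbb{Z}[x]$ and $q_k(x)=\sum_{j=0}^{e_k}a'_jx^j$, integers $0\le a'_j<p$, $a'_{e_k}\neq0$, then $e\ge p-1$ and $\deg(q_k)\le e-p+1$.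
   Context: A polynomial in $\mathbb{Z}[x]$ is primitive if the gcd of its coefficients is $1$. A prime $p$ is a fixed prime divisor of $g\in\mathbb{Z}[x]$ if $p\mid g(n)$ for all $n\in\mathbb{Z}$. -}

module Defs where

open import Data.Nat as ℕ using (ℕ; zero; suc)
open import Data.Nat.GCD using (gcd)
open import Data.Integer as ℤ using (ℤ; +_; ∣_∣)
open import Data.Integer.Divisibility using (_∣_)
open import Data.List using (List; []; _∷_; map; foldr)
open import Data.Product using (_×_)
open import Relation.Binary.PropositionalEquality using (_≡_; _≢_)

-- Polynomials in ℤ[x] as coefficient lists, constant term first.
-- Trailing zeros are allowed; equality of polynomials is ≈ₚ (coefficientwise).
Poly : Set
Poly = List ℤ

coeff : Poly → ℕ → ℤ
coeff []      _       = + 0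
coeff (a ∷ f) zero    = a
coeff (a ∷ f) (suc i) = coeff f i

infix 4 _≈ₚ_
_≈ₚ_ : Poly → Poly → Set
f ≈ₚ g = ∀ i → coeff f i ≡ coeff g i

infixl 6 _+ₚ_
_+ₚ_ : Poly → Poly → Poly
[]      +ₚ g       = g
(a ∷ f) +ₚ []      = a ∷ f
(a ∷ f) +ₚ (b ∷ g) = (a ℤ.+ b) ∷ (f +ₚ g)

infixl 7 _·ₚ_
_·ₚ_ : ℤ → Poly → Poly
c ·ₚ f = map (c ℤ.*_) f

-ₚ_ : Poly → Poly
-ₚ f = map ℤ.-_ f

infixl 7 _*ₚ_
_*ₚ_ : Poly → Poly → Poly
[]      *ₚ g = []
(a ∷ f) *ₚ g = (a ·ₚ g) +ₚ (+ 0 ∷ (f *ₚ g))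

const : ℤ → Poly
const c = c ∷ []

X : Poly
X = + 0 ∷ + 1 ∷ []

infixr 8 _^ₚ_
_^ₚ_ : Poly → ℕ → Poly
f ^ₚ zero  = const (+ 1)
f ^ₚ suc n = f *ₚ (f ^ₚ n)

eval : Poly → ℤ → ℤ
eval f x = foldr (λ a acc → a ℤ.+ x ℤ.* acc) (+ 0) f

compose : Poly → Poly → Poly
compose f g = foldr (λ a acc → const a +ₚ (g *ₚ acc)) [] f

content : Poly → ℕ
content f = foldr (λ a c → gcd ∣ a ∣ c) 0 f

Primitive : Poly → Set
Primitive f = content f ≡ 1

-- p is a fixed prime divisor of g (primality of p is assumed separately)
FixedPrimeDivisor : ℕ → Poly → Set
FixedPrimeDivisor p g = ∀ (n : ℤ) → + p ∣ eval g n

DigitPoly : ℕ → ℕ → Poly → Set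
DigitPoly p e q =
  (∀ j → (+ 0 ℤ.≤ coeff q j) × (coeff q j ℤ.< + p)) ×
  (coeff q e ≢ + 0) ×
  (∀ j → e ℕ.< j → coeff q j ≡ + 0)

shape : ℕ → Poly → Poly → Poly
shape p q r = ((X ^ₚ p) +ₚ (-ₚ X)) *ₚ q +ₚ (+ p ·ₚ r)

-- Put π(x) = f(x + k) and α(x) = q(x + k). Then f(px + k) = π(px) has coefficients pⁱπᵢ, and π is
-- primitive because substituting x − k undoes the translation. Modulo p, π ≡ ((x + k)ᵖ − (x + k)) α,
-- so Fermat's little theorem gives p ∣ π₀, and if j is the first index with p ∤ αⱼ (there is one,
-- j ≤ e, since αₑ = qₑ is a nonzero digit) then π_{j+1} ≡ −αⱼ. Hence the content of π(px) is p^(ν+1)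
-- with ν ≤ j ≤ e, and f_k = π(px)/p^(ν+1) is primitive with every coefficient beyond degree ν + 1
-- divisible by p. If f_k = (xᵖ − x) q_k + p r_k with q_k a digit polynomial of degree e_k, its
-- coefficient of x^(p + e_k) is the leading digit of q_k modulo p, so p + e_k ≤ ν + 1 ≤ e + 1.

module Submission where

open import Defs
open import Data.Nat as ℕ using (ℕ; zero; suc; _≤_; _<_; z≤n; s≤s; _!; _∸_)
import Data.Nat.Properties as ℕ
import Data.Nat.Divisibility as ℕ
open import Data.Nat.Combinatorics using (_C_; nCn≡1; nCk≡n!/k![n-k]!; k![n∸k]!∣n!)
open import Data.Nat.Coprimality using (Coprime; coprime-divisor)
open import Data.Nat.DivMod using (m/n*n≡m)
open import Data.Nat.GCD using (gcd; gcd[m,n]∣m; gcd[m,n]∣n; gcd-greatest; c*gcd[m,n]≡gcd[cm,cn])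
open import Data.Nat.Induction using (<-wellFounded)
open import Data.Nat.Primality using (Prime; euclidsLemma; prime⇒nonZero; prime⇒nonTrivial; prime⇒irreducible)
open import Data.Integer as ℤ using (ℤ; +_; -_; _+_; _*_; _-_; _^_)
open import Data.Integer.Properties
open import Data.Integer.Divisibility.Signed
  using (_∣_; _∣?_; divides; ∣-refl; ∣ᵤ⇒∣; ∣⇒∣ᵤ; ∣m∣n⇒∣m+n; ∣m+n∣n⇒∣m; ∣m⇒∣-m; ∣n⇒∣m*n; ∣m⇒∣m*n)
open import Data.Integer.Tactic.RingSolver using (solve-∀)
open import Data.Fin as Fin using (Fin; toℕ; fromℕ; fromℕ<; inject₁)
open import Data.Fin.Properties using (toℕ<n; toℕ-fromℕ; toℕ-fromℕ<; toℕ-inject; toℕ-inject₁; ¬∀⟶∃¬-smallest)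
open import Data.List using ([]; _∷_)
open import Data.Product using (_×_; _,_; proj₁; proj₂; ∃-syntax)
open import Data.Sum using (inj₁; inj₂)
open import Function using (_∘_)
open import Induction.WellFounded using (Acc; acc)
open import Relation.Nullary using (¬_; contradiction; Dec; yes; no)
open import Relation.Nullary.Decidable using (map′)
open import Relation.Binary.Bundles using (Setoid)
open import Relation.Binary.PropositionalEquality
import Relation.Binary.Reasoning.Setoid as SetoidReasoning
open import Algebra.Properties.CommutativeSemigroup *-commutativeSemigroup using (x∙yz≈y∙xz)
open import Algebra.Properties.CommutativeSemigroup +-commutativeSemigroup using () renaming (interchange to +-interchange)
open import Algebra.Properties.CommutativeSemiring.Binomial +-*-commutativeSemiring
  using (theorem; binomial; binomialTerm)
open import Algebra.Properties.Semiring.Sum +-*-semiring using (sum; sum-init-last)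
import Algebra.Properties.Semiring.Exp +-*-semiring as Exp
import Algebra.Definitions.RawMonoid ℤ.+-0-rawMonoid as Mult

-- Coefficients of sums and products

coeff-+ₚ : ∀ f g i → coeff (f +ₚ g) i ≡ coeff f i + coeff g i
coeff-+ₚ []      g       i       = sym (+-identityˡ _)
coeff-+ₚ (a ∷ f) []      i       = sym (+-identityʳ _)
coeff-+ₚ (a ∷ f) (b ∷ g) zero    = refl
coeff-+ₚ (a ∷ f) (b ∷ g) (suc i) = coeff-+ₚ f g i

coeff-·ₚ : ∀ c f i → coeff (c ·ₚ f) i ≡ c * coeff f i
coeff-·ₚ c []      i       = sym (*-zeroʳ c)
coeff-·ₚ c (a ∷ f) zero    = refl
coeff-·ₚ c (a ∷ f) (suc i) = coeff-·ₚ c f i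

-- convolution F G n = Σ_{i + j = n} F i * G j
convolution : (ℕ → ℤ) → (ℕ → ℤ) → ℕ → ℤ
convolution F G zero    = F 0 * G 0
convolution F G (suc n) = F 0 * G (suc n) + convolution (F ∘ suc) G n

convolution-cong : ∀ {F F′ G G′} → F ≗ F′ → G ≗ G′ → convolution F G ≗ convolution F′ G′
convolution-cong F≗F′ G≗G′ zero    = cong₂ _*_ (F≗F′ 0) (G≗G′ 0)
convolution-cong F≗F′ G≗G′ (suc n) =
  cong₂ _+_ (cong₂ _*_ (F≗F′ 0) (G≗G′ (suc n))) (convolution-cong (F≗F′ ∘ suc) G≗G′ n)

convolution-zeroˡ : ∀ {F} G → (∀ i → F i ≡ + 0) → ∀ n → convolution F G n ≡ + 0
convolution-zeroˡ G F≡0 zero    rewrite F≡0 0 = refl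
convolution-zeroˡ G F≡0 (suc n) rewrite F≡0 0 =
  trans (+-identityˡ _) (convolution-zeroˡ G (F≡0 ∘ suc) n)

convolution-zeroʳ : ∀ F {G} → (∀ i → G i ≡ + 0) → ∀ n → convolution F G n ≡ + 0
convolution-zeroʳ F G≡0 zero    rewrite G≡0 0 = *-zeroʳ (F 0)
convolution-zeroʳ F G≡0 (suc n) rewrite G≡0 (suc n) | *-zeroʳ (F 0) =
  trans (+-identityˡ _) (convolution-zeroʳ (F ∘ suc) G≡0 n)

convolution-distribˡ-+ : ∀ F G H n →
  convolution F (λ i → G i + H i) n ≡ convolution F G n + convolution F H n
convolution-distribˡ-+ F G H zero    = *-distribˡ-+ (F 0) (G 0) (H 0)
convolution-distribˡ-+ F G H (suc n)
  rewrite convolution-distribˡ-+ (F ∘ suc) G H n | *-distribˡ-+ (F 0) (G (suc n)) (H (suc n)) =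
  +-interchange (F 0 * G (suc n)) _ _ _

convolution-distribʳ-+ : ∀ F G H n →
  convolution (λ i → F i + G i) H n ≡ convolution F H n + convolution G H n
convolution-distribʳ-+ F G H zero    = *-distribʳ-+ (H 0) (F 0) (G 0)
convolution-distribʳ-+ F G H (suc n)
  rewrite convolution-distribʳ-+ (F ∘ suc) (G ∘ suc) H n | *-distribʳ-+ (H (suc n)) (F 0) (G 0) =
  +-interchange (F 0 * H (suc n)) _ _ _

convolution-*ʳ : ∀ F G c n → convolution F (λ i → c * G i) n ≡ c * convolution F G n
convolution-*ʳ F G c zero    = x∙yz≈y∙xz (F 0) c (G 0)
convolution-*ʳ F G c (suc n) rewrite convolution-*ʳ (F ∘ suc) G c n =
  trans (cong (_+ c * _) (x∙yz≈y∙xz (F 0) c (G (suc n)))) (sym (*-distribˡ-+ c _ _))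

∣-convolution : ∀ {d} F G → (∀ i → d ∣ G i) → ∀ n → d ∣ convolution F G n
∣-convolution F G d∣G zero    = ∣n⇒∣m*n (F 0) (d∣G 0)
∣-convolution F G d∣G (suc n) = ∣m∣n⇒∣m+n (∣n⇒∣m*n (F 0) (d∣G (suc n))) (∣-convolution (F ∘ suc) G d∣G n)

coeff-*ₚ : ∀ f g n → coeff (f *ₚ g) n ≡ convolution (coeff f) (coeff g) n
coeff-*ₚ []      g n       = sym (convolution-zeroˡ (coeff g) (λ _ → refl) n)
coeff-*ₚ (a ∷ f) g zero    = trans (coeff-+ₚ (a ·ₚ g) _ 0) (trans (+-identityʳ _) (coeff-·ₚ a g 0))
coeff-*ₚ (a ∷ f) g (suc n) = trans (coeff-+ₚ (a ·ₚ g) _ (suc n)) (cong₂ _+_ (coeff-·ₚ a g (suc n)) (coeff-*ₚ f g n))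

*ₚ-congˡ : ∀ f f′ g → f ≈ₚ f′ → f *ₚ g ≈ₚ f′ *ₚ g
*ₚ-congˡ f f′ g f≈f′ n = begin
  coeff (f *ₚ g) n                    ≡⟨ coeff-*ₚ f g n ⟩
  convolution (coeff f) (coeff g) n    ≡⟨ convolution-cong f≈f′ (λ _ → refl) n ⟩
  convolution (coeff f′) (coeff g) n   ≡⟨ sym (coeff-*ₚ f′ g n) ⟩
  coeff (f′ *ₚ g) n                   ∎
  where open ≡-Reasoning

*ₚ-congʳ : ∀ f g g′ → g ≈ₚ g′ → f *ₚ g ≈ₚ f *ₚ g′
*ₚ-congʳ f g g′ g≈g′ n = begin
  coeff (f *ₚ g) n                    ≡⟨ coeff-*ₚ f g n ⟩
  convolution (coeff f) (coeff g) n    ≡⟨ convolution-cong (λ _ → refl) g≈g′ n ⟩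
  convolution (coeff f) (coeff g′) n   ≡⟨ sym (coeff-*ₚ f g′ n) ⟩
  coeff (f *ₚ g′) n                   ∎
  where open ≡-Reasoning

*ₚ-zero : ∀ f g → g ≈ₚ [] → f *ₚ g ≈ₚ []
*ₚ-zero f g g≈0 n = trans (coeff-*ₚ f g n) (convolution-zeroʳ (coeff f) g≈0 n)

*ₚ-distribˡ-+ₚ : ∀ f g h → f *ₚ (g +ₚ h) ≈ₚ f *ₚ g +ₚ f *ₚ h
*ₚ-distribˡ-+ₚ f g h n = begin
  coeff (f *ₚ (g +ₚ h)) n                                            ≡⟨ coeff-*ₚ f (g +ₚ h) n ⟩
  convolution (coeff f) (coeff (g +ₚ h)) n                            ≡⟨ convolution-cong (λ _ → refl) (coeff-+ₚ g h) n ⟩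
  convolution (coeff f) (λ i → coeff g i + coeff h i) n               ≡⟨ convolution-distribˡ-+ (coeff f) (coeff g) (coeff h) n ⟩
  convolution (coeff f) (coeff g) n + convolution (coeff f) (coeff h) n ≡⟨ sym (cong₂ _+_ (coeff-*ₚ f g n) (coeff-*ₚ f h n)) ⟩
  coeff (f *ₚ g) n + coeff (f *ₚ h) n                                 ≡⟨ sym (coeff-+ₚ (f *ₚ g) (f *ₚ h) n) ⟩
  coeff (f *ₚ g +ₚ f *ₚ h) n                                         ∎
  where open ≡-Reasoning

*ₚ-distribʳ-+ₚ : ∀ f g h → (f +ₚ g) *ₚ h ≈ₚ f *ₚ h +ₚ g *ₚ h
*ₚ-distribʳ-+ₚ f g h n = begin
  coeff ((f +ₚ g) *ₚ h) n                                            ≡⟨ coeff-*ₚ (f +ₚ g) h n ⟩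
  convolution (coeff (f +ₚ g)) (coeff h) n                            ≡⟨ convolution-cong (coeff-+ₚ f g) (λ _ → refl) n ⟩
  convolution (λ i → coeff f i + coeff g i) (coeff h) n               ≡⟨ convolution-distribʳ-+ (coeff f) (coeff g) (coeff h) n ⟩
  convolution (coeff f) (coeff h) n + convolution (coeff g) (coeff h) n ≡⟨ sym (cong₂ _+_ (coeff-*ₚ f h n) (coeff-*ₚ g h n)) ⟩
  coeff (f *ₚ h) n + coeff (g *ₚ h) n                                 ≡⟨ sym (coeff-+ₚ (f *ₚ h) (g *ₚ h) n) ⟩
  coeff (f *ₚ h +ₚ g *ₚ h) n                                         ∎
  where open ≡-Reasoning

*ₚ-·ₚ : ∀ f c g → f *ₚ (c ·ₚ g) ≈ₚ c ·ₚ (f *ₚ g)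
*ₚ-·ₚ f c g n = begin
  coeff (f *ₚ (c ·ₚ g)) n                    ≡⟨ coeff-*ₚ f (c ·ₚ g) n ⟩
  convolution (coeff f) (coeff (c ·ₚ g)) n    ≡⟨ convolution-cong (λ _ → refl) (coeff-·ₚ c g) n ⟩
  convolution (coeff f) (λ i → c * coeff g i) n ≡⟨ convolution-*ʳ (coeff f) (coeff g) c n ⟩
  c * convolution (coeff f) (coeff g) n       ≡⟨ cong (c *_) (sym (coeff-*ₚ f g n)) ⟩
  c * coeff (f *ₚ g) n                       ≡⟨ sym (coeff-·ₚ c (f *ₚ g) n) ⟩
  coeff (c ·ₚ (f *ₚ g)) n                    ∎
  where open ≡-Reasoning

*ₚ-shiftˡ : ∀ f g → (+ 0 ∷ f) *ₚ g ≈ₚ + 0 ∷ f *ₚ g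
*ₚ-shiftˡ f g n = begin
  coeff ((+ 0 ∷ f) *ₚ g) n
    ≡⟨ coeff-+ₚ (+ 0 ·ₚ g) (+ 0 ∷ f *ₚ g) n ⟩
  coeff (+ 0 ·ₚ g) n + coeff (+ 0 ∷ f *ₚ g) n
    ≡⟨ cong (_+ coeff (+ 0 ∷ f *ₚ g) n) (trans (coeff-·ₚ (+ 0) g n) (*-zeroˡ (coeff g n))) ⟩
  + 0 + coeff (+ 0 ∷ f *ₚ g) n
    ≡⟨ +-identityˡ _ ⟩
  coeff (+ 0 ∷ f *ₚ g) n
    ∎
  where open ≡-Reasoning

convolution-constˡ : ∀ b G n → convolution (coeff (b ∷ [])) G n ≡ b * G n
convolution-constˡ b G zero    = refl
convolution-constˡ b G (suc n) =
  trans (cong (_+_ (b * G (suc n))) (convolution-zeroˡ G (λ _ → refl) n)) (+-identityʳ _)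

*ₚ-identityˡ : ∀ f → const (+ 1) *ₚ f ≈ₚ f
*ₚ-identityˡ f n = trans (coeff-*ₚ (const (+ 1)) f n) (trans (convolution-constˡ (+ 1) (coeff f) n) (*-identityˡ _))

affine : ℤ → ℤ → Poly
affine b a = a ∷ b ∷ []

coeff-affine*ₚ-zero : ∀ b a g → coeff (affine b a *ₚ g) 0 ≡ a * coeff g 0
coeff-affine*ₚ-zero b a g = coeff-*ₚ (affine b a) g 0

coeff-affine*ₚ-suc : ∀ b a g n → coeff (affine b a *ₚ g) (suc n) ≡ a * coeff g (suc n) + b * coeff g n
coeff-affine*ₚ-suc b a g n =
  trans (coeff-*ₚ (affine b a) g (suc n)) (cong (_+_ (a * coeff g (suc n))) (convolution-constˡ b (coeff g) n))

X*ₚ : ∀ f → X *ₚ f ≈ₚ + 0 ∷ f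
X*ₚ f zero    = trans (coeff-affine*ₚ-zero (+ 1) (+ 0) f) (*-zeroˡ (coeff f 0))
X*ₚ f (suc n) = begin
  coeff (X *ₚ f) (suc n)                  ≡⟨ coeff-affine*ₚ-suc (+ 1) (+ 0) f n ⟩
  + 0 * coeff f (suc n) + + 1 * coeff f n  ≡⟨ cong₂ _+_ (*-zeroˡ (coeff f (suc n))) (*-identityˡ (coeff f n)) ⟩
  + 0 + coeff f n                         ≡⟨ +-identityˡ (coeff f n) ⟩
  coeff f n                               ∎
  where open ≡-Reasoning

X^suc*ₚ : ∀ n f → X ^ₚ suc n *ₚ f ≈ₚ X *ₚ (X ^ₚ n *ₚ f)
X^suc*ₚ n f i = begin
  coeff ((X *ₚ X ^ₚ n) *ₚ f) i  ≡⟨ *ₚ-congˡ (X *ₚ X ^ₚ n) (+ 0 ∷ X ^ₚ n) f (X*ₚ (X ^ₚ n)) i ⟩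
  coeff ((+ 0 ∷ X ^ₚ n) *ₚ f) i ≡⟨ *ₚ-shiftˡ (X ^ₚ n) f i ⟩
  coeff (+ 0 ∷ X ^ₚ n *ₚ f) i   ≡⟨ sym (X*ₚ (X ^ₚ n *ₚ f) i) ⟩
  coeff (X *ₚ (X ^ₚ n *ₚ f)) i  ∎
  where open ≡-Reasoning

coeff-X^*ₚ : ∀ n f j → coeff (X ^ₚ n *ₚ f) (n ℕ.+ j) ≡ coeff f j
coeff-X^*ₚ zero    f j = *ₚ-identityˡ f j
coeff-X^*ₚ (suc n) f j = trans (X^suc*ₚ n f (suc n ℕ.+ j)) (trans (X*ₚ (X ^ₚ n *ₚ f) (suc n ℕ.+ j)) (coeff-X^*ₚ n f j))

-- Composition

coeff-compose-∷ : ∀ a f M i → coeff (compose (a ∷ f) M) i ≡ coeff (const a) i + coeff (M *ₚ compose f M) i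
coeff-compose-∷ a f M = coeff-+ₚ (const a) (M *ₚ compose f M)

compose-zero : ∀ f M → f ≈ₚ [] → compose f M ≈ₚ []
compose-zero []      M f≈0 i = refl
compose-zero (a ∷ f) M f≈0 i = begin
  coeff (compose (a ∷ f) M) i
    ≡⟨ coeff-compose-∷ a f M i ⟩
  coeff (const a) i + coeff (M *ₚ compose f M) i
    ≡⟨ cong₂ _+_ (a≈0 i) (*ₚ-zero M (compose f M) (compose-zero f M (f≈0 ∘ suc)) i) ⟩
  + 0
    ∎
  where
  open ≡-Reasoning
  a≈0 : const a ≈ₚ []
  a≈0 zero    = f≈0 0
  a≈0 (suc i) = refl

compose-cong : ∀ f g M → f ≈ₚ g → compose f M ≈ₚ compose g M
compose-cong []      g       M f≈g i = sym (compose-zero g M (sym ∘ f≈g) i)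
compose-cong (a ∷ f) []      M f≈g   = compose-zero (a ∷ f) M f≈g
compose-cong (a ∷ f) (b ∷ g) M f≈g i = begin
  coeff (compose (a ∷ f) M) i
    ≡⟨ coeff-compose-∷ a f M i ⟩
  coeff (const a) i + coeff (M *ₚ compose f M) i
    ≡⟨ cong₂ _+_ (cong (λ c → coeff (const c) i) (f≈g 0)) (*ₚ-congʳ M _ _ (compose-cong f g M (f≈g ∘ suc)) i) ⟩
  coeff (const b) i + coeff (M *ₚ compose g M) i
    ≡⟨ sym (coeff-compose-∷ b g M i) ⟩
  coeff (compose (b ∷ g) M) i
    ∎
  where open ≡-Reasoning

compose-congʳ : ∀ f M M′ → M ≈ₚ M′ → compose f M ≈ₚ compose f M′
compose-congʳ []      M M′ M≈M′ i = refl
compose-congʳ (a ∷ f) M M′ M≈M′ i = begin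
  coeff (compose (a ∷ f) M) i
    ≡⟨ coeff-compose-∷ a f M i ⟩
  coeff (const a) i + coeff (M *ₚ compose f M) i
    ≡⟨ cong (_+_ (coeff (const a) i)) (*ₚ-congˡ M M′ _ M≈M′ i) ⟩
  coeff (const a) i + coeff (M′ *ₚ compose f M) i
    ≡⟨ cong (_+_ (coeff (const a) i)) (*ₚ-congʳ M′ _ _ (compose-congʳ f M M′ M≈M′) i) ⟩
  coeff (const a) i + coeff (M′ *ₚ compose f M′) i
    ≡⟨ sym (coeff-compose-∷ a f M′ i) ⟩
  coeff (compose (a ∷ f) M′) i
    ∎
  where open ≡-Reasoning

compose-+ₚ : ∀ f g M → compose (f +ₚ g) M ≈ₚ compose f M +ₚ compose g M
compose-+ₚ []      g       M i = refl
compose-+ₚ (a ∷ f) []      M i = sym (trans (coeff-+ₚ (compose (a ∷ f) M) [] i) (+-identityʳ _))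
compose-+ₚ (a ∷ f) (b ∷ g) M i = begin
  coeff (compose (a + b ∷ f +ₚ g) M) i
    ≡⟨ coeff-compose-∷ (a + b) (f +ₚ g) M i ⟩
  coeff (const (a + b)) i + coeff (M *ₚ compose (f +ₚ g) M) i
    ≡⟨ cong₂ _+_ (const-+ i)
                 (trans (*ₚ-congʳ M _ _ (compose-+ₚ f g M) i) (*ₚ-distribˡ-+ₚ M (compose f M) (compose g M) i)) ⟩
  (coeff (const a) i + coeff (const b) i) + coeff (M *ₚ compose f M +ₚ M *ₚ compose g M) i
    ≡⟨ cong (_+_ (coeff (const a) i + coeff (const b) i)) (coeff-+ₚ (M *ₚ compose f M) (M *ₚ compose g M) i) ⟩
  (coeff (const a) i + coeff (const b) i) + (coeff (M *ₚ compose f M) i + coeff (M *ₚ compose g M) i)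
    ≡⟨ +-interchange (coeff (const a) i) _ _ _ ⟩
  (coeff (const a) i + coeff (M *ₚ compose f M) i) + (coeff (const b) i + coeff (M *ₚ compose g M) i)
    ≡⟨ sym (cong₂ _+_ (coeff-compose-∷ a f M i) (coeff-compose-∷ b g M i)) ⟩
  coeff (compose (a ∷ f) M) i + coeff (compose (b ∷ g) M) i
    ≡⟨ sym (coeff-+ₚ (compose (a ∷ f) M) (compose (b ∷ g) M) i) ⟩
  coeff (compose (a ∷ f) M +ₚ compose (b ∷ g) M) i
    ∎
  where
  open ≡-Reasoning
  const-+ : ∀ i → coeff (const (a + b)) i ≡ coeff (const a) i + coeff (const b) i
  const-+ zero    = refl
  const-+ (suc i) = refl

compose-·ₚ : ∀ c f M → compose (c ·ₚ f) M ≈ₚ c ·ₚ compose f M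
compose-·ₚ c []      M i = refl
compose-·ₚ c (a ∷ f) M i = begin
  coeff (compose (c * a ∷ c ·ₚ f) M) i
    ≡⟨ coeff-compose-∷ (c * a) (c ·ₚ f) M i ⟩
  coeff (const (c * a)) i + coeff (M *ₚ compose (c ·ₚ f) M) i
    ≡⟨ cong₂ _+_ (const-* i)
                 (trans (*ₚ-congʳ M _ _ (compose-·ₚ c f M) i)
                        (trans (*ₚ-·ₚ M c (compose f M) i) (coeff-·ₚ c (M *ₚ compose f M) i))) ⟩
  c * coeff (const a) i + c * coeff (M *ₚ compose f M) i
    ≡⟨ sym (*-distribˡ-+ c _ _) ⟩
  c * (coeff (const a) i + coeff (M *ₚ compose f M) i)
    ≡⟨ cong (c *_) (sym (coeff-compose-∷ a f M i)) ⟩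
  c * coeff (compose (a ∷ f) M) i
    ≡⟨ sym (coeff-·ₚ c (compose (a ∷ f) M) i) ⟩
  coeff (c ·ₚ compose (a ∷ f) M) i
    ∎
  where
  open ≡-Reasoning
  const-* : ∀ i → coeff (const (c * a)) i ≡ c * coeff (const a) i
  const-* zero    = refl
  const-* (suc i) = sym (*-zeroʳ c)

compose-+0∷ : ∀ f M → compose (+ 0 ∷ f) M ≈ₚ M *ₚ compose f M
compose-+0∷ f M i = trans (coeff-compose-∷ (+ 0) f M i) (trans (cong (_+ coeff (M *ₚ compose f M) i) (const0 i)) (+-identityˡ _))
  where
  const0 : ∀ i → coeff (const (+ 0)) i ≡ + 0
  const0 zero    = refl
  const0 (suc i) = refl

compose-X*ₚ : ∀ f M → compose (X *ₚ f) M ≈ₚ M *ₚ compose f M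
compose-X*ₚ f M i = trans (compose-cong (X *ₚ f) (+ 0 ∷ f) M (X*ₚ f) i) (compose-+0∷ f M i)

mulPow : Poly → ℕ → Poly → Poly
mulPow M zero    g = g
mulPow M (suc n) g = M *ₚ mulPow M n g

compose-X^*ₚ : ∀ n f M → compose (X ^ₚ n *ₚ f) M ≈ₚ mulPow M n (compose f M)
compose-X^*ₚ zero    f M = compose-cong (const (+ 1) *ₚ f) f M (*ₚ-identityˡ f)
compose-X^*ₚ (suc n) f M i = begin
  coeff (compose (X ^ₚ suc n *ₚ f) M) i
    ≡⟨ compose-cong (X ^ₚ suc n *ₚ f) (X *ₚ (X ^ₚ n *ₚ f)) M (X^suc*ₚ n f) i ⟩
  coeff (compose (X *ₚ (X ^ₚ n *ₚ f)) M) i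
    ≡⟨ compose-X*ₚ (X ^ₚ n *ₚ f) M i ⟩
  coeff (M *ₚ compose (X ^ₚ n *ₚ f) M) i
    ≡⟨ *ₚ-congʳ M _ _ (compose-X^*ₚ n f M) i ⟩
  coeff (M *ₚ mulPow M n (compose f M)) i
    ∎
  where open ≡-Reasoning

∣-compose : ∀ {d} f M → (∀ i → d ∣ coeff f i) → ∀ i → d ∣ coeff (compose f M) i
∣-compose {d} []      M d∣f i = divides (+ 0) refl
∣-compose {d} (a ∷ f) M d∣f i =
  subst (d ∣_) (sym (coeff-compose-∷ a f M i)) (∣m∣n⇒∣m+n (d∣a i) d∣M*f)
  where
  d∣a : ∀ i → d ∣ coeff (const a) i
  d∣a zero    = d∣f 0
  d∣a (suc i) = divides (+ 0) refl
  d∣M*f : d ∣ coeff (M *ₚ compose f M) i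
  d∣M*f = subst (d ∣_) (sym (coeff-*ₚ M (compose f M) i)) (∣-convolution (coeff M) _ (∣-compose f M (d∣f ∘ suc)) i)

-X*ₚ : ∀ f → (-ₚ X) *ₚ f ≈ₚ ℤ.-1ℤ ·ₚ (X *ₚ f)
-X*ₚ f zero    = begin
  coeff ((-ₚ X) *ₚ f) 0        ≡⟨ coeff-affine*ₚ-zero ℤ.-1ℤ (+ 0) f ⟩
  + 0 * coeff f 0              ≡⟨ *-zeroˡ (coeff f 0) ⟩
  + 0                          ≡⟨ sym (cong (ℤ.-1ℤ *_) (X*ₚ f 0)) ⟩
  ℤ.-1ℤ * coeff (X *ₚ f) 0     ≡⟨ sym (coeff-·ₚ ℤ.-1ℤ (X *ₚ f) 0) ⟩
  coeff (ℤ.-1ℤ ·ₚ (X *ₚ f)) 0  ∎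
  where open ≡-Reasoning
-X*ₚ f (suc n) = begin
  coeff ((-ₚ X) *ₚ f) (suc n)               ≡⟨ coeff-affine*ₚ-suc ℤ.-1ℤ (+ 0) f n ⟩
  + 0 * coeff f (suc n) + ℤ.-1ℤ * coeff f n  ≡⟨ cong (_+ ℤ.-1ℤ * coeff f n) (*-zeroˡ (coeff f (suc n))) ⟩
  + 0 + ℤ.-1ℤ * coeff f n                   ≡⟨ +-identityˡ _ ⟩
  ℤ.-1ℤ * coeff f n                         ≡⟨ sym (cong (ℤ.-1ℤ *_) (X*ₚ f (suc n))) ⟩
  ℤ.-1ℤ * coeff (X *ₚ f) (suc n)            ≡⟨ sym (coeff-·ₚ ℤ.-1ℤ (X *ₚ f) (suc n)) ⟩
  coeff (ℤ.-1ℤ ·ₚ (X *ₚ f)) (suc n)         ∎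
  where open ≡-Reasoning

shape-expand : ∀ p q r → shape p q r ≈ₚ X ^ₚ p *ₚ q +ₚ ℤ.-1ℤ ·ₚ (X *ₚ q) +ₚ + p ·ₚ r
shape-expand p q r i = begin
  coeff ((X ^ₚ p +ₚ -ₚ X) *ₚ q +ₚ + p ·ₚ r) i
    ≡⟨ coeff-+ₚ ((X ^ₚ p +ₚ -ₚ X) *ₚ q) (+ p ·ₚ r) i ⟩
  coeff ((X ^ₚ p +ₚ -ₚ X) *ₚ q) i + coeff (+ p ·ₚ r) i
    ≡⟨ cong (_+ coeff (+ p ·ₚ r) i)
            (trans (*ₚ-distribʳ-+ₚ (X ^ₚ p) (-ₚ X) q i) (coeff-+ₚ (X ^ₚ p *ₚ q) ((-ₚ X) *ₚ q) i)) ⟩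
  coeff (X ^ₚ p *ₚ q) i + coeff ((-ₚ X) *ₚ q) i + coeff (+ p ·ₚ r) i
    ≡⟨ cong (λ c → coeff (X ^ₚ p *ₚ q) i + c + coeff (+ p ·ₚ r) i) (-X*ₚ q i) ⟩
  coeff (X ^ₚ p *ₚ q) i + coeff (ℤ.-1ℤ ·ₚ (X *ₚ q)) i + coeff (+ p ·ₚ r) i
    ≡⟨ cong (_+ coeff (+ p ·ₚ r) i) (sym (coeff-+ₚ (X ^ₚ p *ₚ q) (ℤ.-1ℤ ·ₚ (X *ₚ q)) i)) ⟩
  coeff (X ^ₚ p *ₚ q +ₚ ℤ.-1ℤ ·ₚ (X *ₚ q)) i + coeff (+ p ·ₚ r) i
    ≡⟨ sym (coeff-+ₚ (X ^ₚ p *ₚ q +ₚ ℤ.-1ℤ ·ₚ (X *ₚ q)) (+ p ·ₚ r) i) ⟩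
  coeff (X ^ₚ p *ₚ q +ₚ ℤ.-1ℤ ·ₚ (X *ₚ q) +ₚ + p ·ₚ r) i
    ∎
  where open ≡-Reasoning

coeff-shape : ∀ p q r i → coeff (shape p q r) i ≡ coeff (X ^ₚ p *ₚ q) i - coeff (X *ₚ q) i + + p * coeff r i
coeff-shape p q r i = begin
  coeff (shape p q r) i
    ≡⟨ shape-expand p q r i ⟩
  coeff (X ^ₚ p *ₚ q +ₚ ℤ.-1ℤ ·ₚ (X *ₚ q) +ₚ + p ·ₚ r) i
    ≡⟨ coeff-+ₚ (X ^ₚ p *ₚ q +ₚ ℤ.-1ℤ ·ₚ (X *ₚ q)) (+ p ·ₚ r) i ⟩
  coeff (X ^ₚ p *ₚ q +ₚ ℤ.-1ℤ ·ₚ (X *ₚ q)) i + coeff (+ p ·ₚ r) i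
    ≡⟨ cong₂ _+_ (coeff-+ₚ (X ^ₚ p *ₚ q) (ℤ.-1ℤ ·ₚ (X *ₚ q)) i) (coeff-·ₚ (+ p) r i) ⟩
  coeff (X ^ₚ p *ₚ q) i + coeff (ℤ.-1ℤ ·ₚ (X *ₚ q)) i + + p * coeff r i
    ≡⟨ cong (λ c → coeff (X ^ₚ p *ₚ q) i + c + + p * coeff r i) (trans (coeff-·ₚ ℤ.-1ℤ (X *ₚ q) i) (-1*i≡-i _)) ⟩
  coeff (X ^ₚ p *ₚ q) i - coeff (X *ₚ q) i + + p * coeff r i
    ∎
  where open ≡-Reasoning

coeff-compose-shape : ∀ p q r M i →
  coeff (compose (shape p q r) M) i
    ≡ coeff (mulPow M p (compose q M)) i - coeff (M *ₚ compose q M) i + + p * coeff (compose r M) i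
coeff-compose-shape p q r M i = begin
  coeff (compose (shape p q r) M) i
    ≡⟨ compose-cong (shape p q r) (A +ₚ B +ₚ R) M (shape-expand p q r) i ⟩
  coeff (compose (A +ₚ B +ₚ R) M) i
    ≡⟨ trans (compose-+ₚ (A +ₚ B) R M i) (coeff-+ₚ (compose (A +ₚ B) M) (compose R M) i) ⟩
  coeff (compose (A +ₚ B) M) i + coeff (compose R M) i
    ≡⟨ cong₂ _+_ (trans (compose-+ₚ A B M i) (coeff-+ₚ (compose A M) (compose B M) i))
                 (trans (compose-·ₚ (+ p) r M i) (coeff-·ₚ (+ p) (compose r M) i)) ⟩
  coeff (compose A M) i + coeff (compose B M) i + + p * coeff (compose r M) i
    ≡⟨ cong₂ (λ a b → a + b + + p * coeff (compose r M) i) (compose-X^*ₚ p q M i) compose-B ⟩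
  coeff (mulPow M p (compose q M)) i - coeff (M *ₚ compose q M) i + + p * coeff (compose r M) i
    ∎
  where
  open ≡-Reasoning
  A = X ^ₚ p *ₚ q
  B = ℤ.-1ℤ ·ₚ (X *ₚ q)
  R = + p ·ₚ r
  compose-B : coeff (compose B M) i ≡ - coeff (M *ₚ compose q M) i
  compose-B = begin
    coeff (compose B M) i                  ≡⟨ compose-·ₚ ℤ.-1ℤ (X *ₚ q) M i ⟩
    coeff (ℤ.-1ℤ ·ₚ compose (X *ₚ q) M) i  ≡⟨ coeff-·ₚ ℤ.-1ℤ (compose (X *ₚ q) M) i ⟩
    ℤ.-1ℤ * coeff (compose (X *ₚ q) M) i   ≡⟨ cong (ℤ.-1ℤ *_) (compose-X*ₚ q M i) ⟩
    ℤ.-1ℤ * coeff (M *ₚ compose q M) i     ≡⟨ -1*i≡-i _ ⟩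
    - coeff (M *ₚ compose q M) i           ∎

-- Affine substitutions

coeff-compose-scale : ∀ f b a i →
  coeff (compose f (affine b a)) i ≡ b ^ i * coeff (compose f (affine (+ 1) a)) i
coeff-compose-scale []      b a i       = sym (*-zeroʳ (b ^ i))
coeff-compose-scale (c ∷ f) b a zero    = begin
  coeff (compose (c ∷ f) (affine b a)) 0
    ≡⟨ coeff-compose-∷ c f (affine b a) 0 ⟩
  c + coeff (affine b a *ₚ g) 0
    ≡⟨ cong (_+_ c) (coeff-affine*ₚ-zero b a g) ⟩
  c + a * coeff g 0
    ≡⟨ cong (λ x → c + a * x) (coeff-compose-scale f b a 0) ⟩
  c + a * (+ 1 * coeff h 0)
    ≡⟨ lemma c a (coeff h 0) ⟩
  + 1 * (c + a * coeff h 0)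
    ≡⟨ cong (λ x → + 1 * (c + x)) (sym (coeff-affine*ₚ-zero (+ 1) a h)) ⟩
  + 1 * (c + coeff (affine (+ 1) a *ₚ h) 0)
    ≡⟨ cong (+ 1 *_) (sym (coeff-compose-∷ c f (affine (+ 1) a) 0)) ⟩
  + 1 * coeff (compose (c ∷ f) (affine (+ 1) a)) 0
    ∎
  where
  open ≡-Reasoning
  g = compose f (affine b a)
  h = compose f (affine (+ 1) a)
  lemma : ∀ c a x → c + a * (+ 1 * x) ≡ + 1 * (c + a * x)
  lemma = solve-∀
coeff-compose-scale (c ∷ f) b a (suc n) = begin
  coeff (compose (c ∷ f) (affine b a)) (suc n)
    ≡⟨ coeff-compose-∷ c f (affine b a) (suc n) ⟩
  + 0 + coeff (affine b a *ₚ g) (suc n)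
    ≡⟨ cong (_+_ (+ 0)) (coeff-affine*ₚ-suc b a g n) ⟩
  + 0 + (a * coeff g (suc n) + b * coeff g n)
    ≡⟨ cong₂ (λ x y → + 0 + (a * x + b * y)) (coeff-compose-scale f b a (suc n)) (coeff-compose-scale f b a n) ⟩
  + 0 + (a * (b ^ suc n * coeff h (suc n)) + b * (b ^ n * coeff h n))
    ≡⟨ lemma a b (b ^ n) (coeff h (suc n)) (coeff h n) ⟩
  b ^ suc n * (+ 0 + (a * coeff h (suc n) + + 1 * coeff h n))
    ≡⟨ cong (λ x → b ^ suc n * (+ 0 + x)) (sym (coeff-affine*ₚ-suc (+ 1) a h n)) ⟩
  b ^ suc n * (+ 0 + coeff (affine (+ 1) a *ₚ h) (suc n))
    ≡⟨ cong (b ^ suc n *_) (sym (coeff-compose-∷ c f (affine (+ 1) a) (suc n))) ⟩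
  b ^ suc n * coeff (compose (c ∷ f) (affine (+ 1) a)) (suc n)
    ∎
  where
  open ≡-Reasoning
  g = compose f (affine b a)
  h = compose f (affine (+ 1) a)
  lemma : ∀ a b bⁿ x y → + 0 + (a * (b * bⁿ * x) + b * (bⁿ * y)) ≡ b * bⁿ * (+ 0 + (a * x + + 1 * y))
  lemma = solve-∀

translate*ₚ : ∀ a g → affine (+ 1) a *ₚ g ≈ₚ a ·ₚ g +ₚ (+ 0 ∷ g)
translate*ₚ a g zero    = begin
  coeff (affine (+ 1) a *ₚ g) 0  ≡⟨ coeff-affine*ₚ-zero (+ 1) a g ⟩
  a * coeff g 0                  ≡⟨ sym (trans (cong (_+ + 0) (coeff-·ₚ a g 0)) (+-identityʳ _)) ⟩
  coeff (a ·ₚ g) 0 + + 0         ≡⟨ sym (coeff-+ₚ (a ·ₚ g) (+ 0 ∷ g) 0) ⟩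
  coeff (a ·ₚ g +ₚ (+ 0 ∷ g)) 0  ∎
  where open ≡-Reasoning
translate*ₚ a g (suc n) = begin
  coeff (affine (+ 1) a *ₚ g) (suc n)      ≡⟨ coeff-affine*ₚ-suc (+ 1) a g n ⟩
  a * coeff g (suc n) + + 1 * coeff g n    ≡⟨ cong₂ _+_ (sym (coeff-·ₚ a g (suc n))) (*-identityˡ (coeff g n)) ⟩
  coeff (a ·ₚ g) (suc n) + coeff g n       ≡⟨ sym (coeff-+ₚ (a ·ₚ g) (+ 0 ∷ g) (suc n)) ⟩
  coeff (a ·ₚ g +ₚ (+ 0 ∷ g)) (suc n)      ∎
  where open ≡-Reasoning

compose-translate*ₚ : ∀ a h M → compose (affine (+ 1) a *ₚ h) M ≈ₚ a ·ₚ compose h M +ₚ M *ₚ compose h M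
compose-translate*ₚ a h M i = begin
  coeff (compose (affine (+ 1) a *ₚ h) M) i
    ≡⟨ compose-cong (affine (+ 1) a *ₚ h) (a ·ₚ h +ₚ (+ 0 ∷ h)) M (translate*ₚ a h) i ⟩
  coeff (compose (a ·ₚ h +ₚ (+ 0 ∷ h)) M) i
    ≡⟨ trans (compose-+ₚ (a ·ₚ h) (+ 0 ∷ h) M i) (coeff-+ₚ (compose (a ·ₚ h) M) (compose (+ 0 ∷ h) M) i) ⟩
  coeff (compose (a ·ₚ h) M) i + coeff (compose (+ 0 ∷ h) M) i
    ≡⟨ cong₂ _+_ (compose-·ₚ a h M i) (compose-+0∷ h M i) ⟩
  coeff (a ·ₚ compose h M) i + coeff (M *ₚ compose h M) i
    ≡⟨ sym (coeff-+ₚ (a ·ₚ compose h M) (M *ₚ compose h M) i) ⟩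
  coeff (a ·ₚ compose h M +ₚ M *ₚ compose h M) i
    ∎
  where open ≡-Reasoning

compose-translate-inverse : ∀ f a → compose (compose f (affine (+ 1) a)) (affine (+ 1) (- a)) ≈ₚ f
compose-translate-inverse []      a i = refl
compose-translate-inverse (c ∷ f) a i = begin
  coeff (compose (const c +ₚ T *ₚ h) S) i
    ≡⟨ trans (compose-+ₚ (const c) (T *ₚ h) S i) (coeff-+ₚ (compose (const c) S) (compose (T *ₚ h) S) i) ⟩
  coeff (compose (const c) S) i + coeff (compose (T *ₚ h) S) i
    ≡⟨ cong₂ _+_ compose-const (trans (compose-translate*ₚ a h S i) (coeff-+ₚ (a ·ₚ Y) (S *ₚ Y) i)) ⟩
  coeff (const c) i + (coeff (a ·ₚ Y) i + coeff (S *ₚ Y) i)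
    ≡⟨ cong (λ x → coeff (const c) i + (x + coeff (S *ₚ Y) i)) (coeff-·ₚ a Y i) ⟩
  coeff (const c) i + (a * coeff Y i + coeff (S *ₚ Y) i)
    ≡⟨ cancel i ⟩
  coeff (c ∷ f) i
    ∎
  where
  open ≡-Reasoning
  T = affine (+ 1) a
  S = affine (+ 1) (- a)
  h = compose f T
  Y = compose h S
  compose-const : coeff (compose (const c) S) i ≡ coeff (const c) i
  compose-const =
    trans (coeff-compose-∷ c [] S i) (trans (cong (_+_ (coeff (const c) i)) (*ₚ-zero S [] (λ _ → refl) i)) (+-identityʳ _))
  cancel : ∀ i → coeff (const c) i + (a * coeff Y i + coeff (S *ₚ Y) i) ≡ coeff (c ∷ f) i
  cancel zero    = begin
    c + (a * coeff Y 0 + coeff (S *ₚ Y) 0)    ≡⟨ cong (λ x → c + (a * coeff Y 0 + x)) (coeff-affine*ₚ-zero (+ 1) (- a) Y) ⟩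
    c + (a * coeff Y 0 + - a * coeff Y 0)     ≡⟨ lemma c a (coeff Y 0) ⟩
    c                                        ∎
    where
    lemma : ∀ c a y → c + (a * y + - a * y) ≡ c
    lemma = solve-∀
  cancel (suc n) = begin
    + 0 + (a * coeff Y (suc n) + coeff (S *ₚ Y) (suc n))
      ≡⟨ cong (λ x → + 0 + (a * coeff Y (suc n) + x)) (coeff-affine*ₚ-suc (+ 1) (- a) Y n) ⟩
    + 0 + (a * coeff Y (suc n) + (- a * coeff Y (suc n) + + 1 * coeff Y n))
      ≡⟨ lemma a (coeff Y (suc n)) (coeff Y n) ⟩
    coeff Y n
      ≡⟨ compose-translate-inverse f a n ⟩
    coeff f n
      ∎
    where
    lemma : ∀ a y z → + 0 + (a * y + (- a * y + + 1 * z)) ≡ z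
    lemma = solve-∀

DegreeAtMost : ℕ → Poly → Set
DegreeAtMost n f = ∀ j → n < j → coeff f j ≡ + 0

compose-affine-degree : ∀ f b a n → DegreeAtMost n f → DegreeAtMost n (compose f (affine b a))
compose-affine-degree []      b a n       deg j       _         = refl
compose-affine-degree (c ∷ f) b a zero    deg (suc j) _         =
  trans (coeff-compose-∷ c f M (suc j)) (cong (_+_ (+ 0)) (*ₚ-zero M (compose f M) (compose-zero f M f≈0) (suc j)))
  where
  M = affine b a
  f≈0 : f ≈ₚ []
  f≈0 i = deg (suc i) (s≤s z≤n)
compose-affine-degree (c ∷ f) b a (suc n) deg (suc j) (s≤s n<j) = begin
  coeff (compose (c ∷ f) (affine b a)) (suc j)
    ≡⟨ coeff-compose-∷ c f (affine b a) (suc j) ⟩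
  + 0 + coeff (affine b a *ₚ g) (suc j)
    ≡⟨ cong (_+_ (+ 0)) (coeff-affine*ₚ-suc b a g j) ⟩
  + 0 + (a * coeff g (suc j) + b * coeff g j)
    ≡⟨ cong₂ (λ x y → + 0 + (a * x + b * y)) (deg-g (suc j) (ℕ.m<n⇒m<1+n n<j)) (deg-g j n<j) ⟩
  + 0 + (a * + 0 + b * + 0)
    ≡⟨ lemma a b ⟩
  + 0
    ∎
  where
  open ≡-Reasoning
  g = compose f (affine b a)
  deg-g : DegreeAtMost n g
  deg-g = compose-affine-degree f b a n (λ j n<j → deg (suc j) (s≤s n<j))
  lemma : ∀ a b → + 0 + (a * + 0 + b * + 0) ≡ + 0
  lemma = solve-∀

coeff-compose-affine-top : ∀ f b a n → DegreeAtMost n f → coeff (compose f (affine b a)) n ≡ b ^ n * coeff f n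
coeff-compose-affine-top []      b a n       deg = sym (*-zeroʳ (b ^ n))
coeff-compose-affine-top (c ∷ f) b a zero    deg = begin
  coeff (compose (c ∷ f) (affine b a)) 0
    ≡⟨ coeff-compose-∷ c f (affine b a) 0 ⟩
  c + coeff (affine b a *ₚ g) 0
    ≡⟨ cong (_+_ c) (*ₚ-zero (affine b a) g (compose-zero f (affine b a) (λ i → deg (suc i) (s≤s z≤n))) 0) ⟩
  c + + 0
    ≡⟨ trans (+-identityʳ c) (sym (*-identityˡ c)) ⟩
  + 1 * c
    ∎
  where
  open ≡-Reasoning
  g = compose f (affine b a)
coeff-compose-affine-top (c ∷ f) b a (suc n) deg = begin
  coeff (compose (c ∷ f) (affine b a)) (suc n)
    ≡⟨ coeff-compose-∷ c f (affine b a) (suc n) ⟩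
  + 0 + coeff (affine b a *ₚ g) (suc n)
    ≡⟨ cong (_+_ (+ 0)) (coeff-affine*ₚ-suc b a g n) ⟩
  + 0 + (a * coeff g (suc n) + b * coeff g n)
    ≡⟨ cong₂ (λ x y → + 0 + (a * x + b * y))
             (compose-affine-degree f b a n deg-f (suc n) (ℕ.n<1+n n)) (coeff-compose-affine-top f b a n deg-f) ⟩
  + 0 + (a * + 0 + b * (b ^ n * coeff f n))
    ≡⟨ lemma a b (b ^ n) (coeff f n) ⟩
  b * b ^ n * coeff f n
    ∎
  where
  open ≡-Reasoning
  g = compose f (affine b a)
  deg-f : DegreeAtMost n f
  deg-f j n<j = deg (suc j) (s≤s n<j)
  lemma : ∀ a b bⁿ x → + 0 + (a * + 0 + b * (bⁿ * x)) ≡ b * bⁿ * x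
  lemma = solve-∀

-- Congruences

-- A record rather than a definition, so that x, y and m can be inferred from a proof.
infix 4 _≡_mod_
record _≡_mod_ (x y m : ℤ) : Set where
  constructor congruent
  field divides-difference : m ∣ x - y

open _≡_mod_

mod-setoid : ℤ → Setoid _ _
mod-setoid m = record
  { Carrier       = ℤ
  ; _≈_           = λ x y → x ≡ y mod m
  ; isEquivalence = record
    { refl  = λ {x} → congruent (subst (m ∣_) (sym (+-inverseʳ x)) (divides (+ 0) refl))
    ; sym   = λ {x} {y} x≡y → congruent (subst (m ∣_) (negate-difference x y) (∣m⇒∣-m (divides-difference x≡y)))
    ; trans = λ {x} {y} {z} x≡y y≡z →
        congruent (subst (m ∣_) (telescope x y z) (∣m∣n⇒∣m+n (divides-difference x≡y) (divides-difference y≡z)))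
    }
  }
  where
  negate-difference : ∀ x y → - (x - y) ≡ y - x
  negate-difference = solve-∀
  telescope : ∀ x y z → (x - y) + (y - z) ≡ x - z
  telescope = solve-∀

module _ {m : ℤ} where

  ≡⇒≡-mod : ∀ {x y} → x ≡ y → x ≡ y mod m
  ≡⇒≡-mod = Setoid.reflexive (mod-setoid m)

  ∣⇒≡0-mod : ∀ {x} → m ∣ x → x ≡ + 0 mod m
  ∣⇒≡0-mod {x} m∣x = congruent (subst (m ∣_) (sym (+-identityʳ x)) m∣x)

  ≡0-mod⇒∣ : ∀ {x} → x ≡ + 0 mod m → m ∣ x
  ≡0-mod⇒∣ {x} (congruent m∣x) = subst (m ∣_) (+-identityʳ x) m∣x

  +-cong-mod : ∀ {x x′ y y′} → x ≡ x′ mod m → y ≡ y′ mod m → x + y ≡ x′ + y′ mod m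
  +-cong-mod {x} {x′} {y} {y′} (congruent m∣x-x′) (congruent m∣y-y′) =
    congruent (subst (m ∣_) (regroup x x′ y y′) (∣m∣n⇒∣m+n m∣x-x′ m∣y-y′))
    where
    regroup : ∀ x x′ y y′ → (x - x′) + (y - y′) ≡ (x + y) - (x′ + y′)
    regroup = solve-∀

  *-congˡ-mod : ∀ c {x y} → x ≡ y mod m → c * x ≡ c * y mod m
  *-congˡ-mod c {x} {y} (congruent m∣x-y) = congruent (subst (m ∣_) (*-distribˡ-minus c x y) (∣n⇒∣m*n c m∣x-y))
    where
    *-distribˡ-minus : ∀ c x y → c * (x - y) ≡ c * x - c * y
    *-distribˡ-minus = solve-∀

  *-congʳ-mod : ∀ c {x y} → x ≡ y mod m → x * c ≡ y * c mod m
  *-congʳ-mod c {x} {y} x≡y = subst₂ (λ u v → u ≡ v mod m) (*-comm c x) (*-comm c y) (*-congˡ-mod c x≡y)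

  -‿cong-mod : ∀ {x y} → x ≡ y mod m → - x ≡ - y mod m
  -‿cong-mod {x} {y} (congruent m∣x-y) = congruent (subst (m ∣_) (neg-distrib-minus x y) (∣m⇒∣-m m∣x-y))
    where
    neg-distrib-minus : ∀ x y → - (x - y) ≡ - x - - y
    neg-distrib-minus = solve-∀

  multiple≡0-mod : ∀ x → m * x ≡ + 0 mod m
  multiple≡0-mod x = ∣⇒≡0-mod (∣m⇒∣m*n x ∣-refl)

_≡?_mod_ : ∀ x y m → Dec (x ≡ y mod m)
x ≡? y mod m = map′ congruent divides-difference (m ∣? x - y)

-- Fermat's little theorem

prime⇒1<p : ∀ {p} → Prime p → 1 < p
prime⇒1<p {p} prime-p = ℕ.nonTrivial⇒n>1 p {{prime⇒nonTrivial prime-p}}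

prime∤! : ∀ {p m} → Prime p → m < p → ¬ p ℕ.∣ m !
prime∤! {p} {zero} prime-p _ p∣1 = ℕ.<⇒≢ (prime⇒1<p prime-p) (sym (ℕ.∣1⇒≡1 p∣1))
prime∤! {p} {suc m} prime-p m<p p∣m! with euclidsLemma (suc m) (m !) prime-p p∣m!
... | inj₁ p∣m = ℕ.<⇒≱ m<p (ℕ.∣⇒≤ p∣m)
... | inj₂ p∣m! = prime∤! prime-p (ℕ.<-trans (ℕ.n<1+n m) m<p) p∣m!

prime∣C : ∀ {p i} → Prime p → 0 < i → i < p → p ℕ.∣ p C i
prime∣C {p@(suc n)} {i} prime-p 0<i i<p with euclidsLemma (p C i) d prime-p p∣C*d
  where
  d = i ! ℕ.* (p ∸ i) !
  instance _ = ℕ._!*_!≢0 i (p ∸ i)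
  p∣C*d : p ℕ.∣ (p C i) ℕ.* d
  p∣C*d = subst (p ℕ.∣_) (sym p!≡C*d) (ℕ.m∣m*n (n !))
    where
    p!≡C*d : (p C i) ℕ.* d ≡ p !
    p!≡C*d = trans (cong (ℕ._* d) (nCk≡n!/k![n-k]! (ℕ.<⇒≤ i<p))) (m/n*n≡m (k![n∸k]!∣n! (ℕ.<⇒≤ i<p)))
... | inj₁ p∣C = p∣C
... | inj₂ p∣d with euclidsLemma (i !) ((p ∸ i) !) prime-p p∣d
...   | inj₁ p∣i! = contradiction p∣i! (prime∤! prime-p i<p)
...   | inj₂ p∣j! = contradiction p∣j! (prime∤! prime-p (ℕ.∸-monoʳ-< 0<i (ℕ.<⇒≤ i<p)))

^-Exp : ∀ x n → x ^ n ≡ x Exp.^ n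
^-Exp x zero    = refl
^-Exp x (suc n) = cong (x *_) (^-Exp x n)

×-* : ∀ n x → n Mult.× x ≡ + n * x
×-* zero    x = sym (*-zeroˡ x)
×-* (suc n) x = begin
  x + n Mult.× x     ≡⟨ cong (_+_ x) (×-* n x) ⟩
  x + + n * x        ≡⟨ sym (cong (_+ + n * x) (*-identityˡ x)) ⟩
  + 1 * x + + n * x  ≡⟨ sym (*-distribʳ-+ x (+ 1) (+ n)) ⟩
  + suc n * x        ∎
  where open ≡-Reasoning

∣-sum : ∀ {d n} (t : Fin n → ℤ) → (∀ i → d ∣ t i) → d ∣ sum t
∣-sum {d} {zero}  t d∣t = divides (+ 0) refl
∣-sum {d} {suc n} t d∣t = ∣m∣n⇒∣m+n (d∣t Fin.zero) (∣-sum (t ∘ Fin.suc) (d∣t ∘ Fin.suc))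

freshmans-dream : ∀ {p} → Prime p → ∀ x y → (x + y) ^ p ≡ x ^ p + y ^ p mod + p
freshmans-dream {p@(suc n)} prime-p x y = congruent (subst (+ p ∣_) (sym expansion) (∣-sum middle p∣middle))
  where
  t : Fin (suc p) → ℤ
  t = binomialTerm x y p
  middle : Fin n → ℤ
  middle i = t (Fin.suc (inject₁ i))
  p∣middle : ∀ i → + p ∣ middle i
  p∣middle i = subst (+ p ∣_) (sym (×-* (p C j) b)) (∣m⇒∣m*n b (∣ᵤ⇒∣ {+ p} {+ (p C j)} p∣C))
    where
    j = suc (toℕ (inject₁ i))
    b = binomial x y p (Fin.suc (inject₁ i))
    p∣C : p ℕ.∣ p C j
    p∣C = prime∣C prime-p (s≤s z≤n) (s≤s (subst (_< n) (sym (toℕ-inject₁ i)) (toℕ<n i)))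
  first : t Fin.zero ≡ y ^ p
  first = begin
    (p C 0) Mult.× (+ 1 * y Exp.^ p) ≡⟨ ×-* (p C 0) _ ⟩
    + 1 * (+ 1 * y Exp.^ p)          ≡⟨ trans (*-identityˡ _) (*-identityˡ _) ⟩
    y Exp.^ p                        ≡⟨ sym (^-Exp y p) ⟩
    y ^ p                            ∎
    where open ≡-Reasoning
  final : t (Fin.suc (fromℕ n)) ≡ x ^ p
  final = begin
    term (suc (toℕ (fromℕ n)))                   ≡⟨ cong (term ∘ suc) (toℕ-fromℕ n) ⟩
    (p C p) Mult.× (x Exp.^ p * y Exp.^ (p ∸ p)) ≡⟨ ×-* (p C p) _ ⟩
    + (p C p) * (x Exp.^ p * y Exp.^ (p ∸ p))    ≡⟨ cong₂ (λ c m → + c * (x Exp.^ p * y Exp.^ m)) (nCn≡1 p) (ℕ.n∸n≡0 p) ⟩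
    + 1 * (x Exp.^ p * + 1)                      ≡⟨ trans (*-identityˡ _) (*-identityʳ _) ⟩
    x Exp.^ p                                    ≡⟨ sym (^-Exp x p) ⟩
    x ^ p                                        ∎
    where
    open ≡-Reasoning
    term : ℕ → ℤ
    term j = (p C j) Mult.× (x Exp.^ j * y Exp.^ (p ∸ j))
  expansion : (x + y) ^ p - (x ^ p + y ^ p) ≡ sum middle
  expansion = begin
    (x + y) ^ p - (x ^ p + y ^ p)
      ≡⟨ cong (_- (x ^ p + y ^ p)) (trans (^-Exp (x + y) p) (theorem p x y)) ⟩
    t Fin.zero + sum (t ∘ Fin.suc) - (x ^ p + y ^ p)
      ≡⟨ cong (λ s → t Fin.zero + s - (x ^ p + y ^ p)) (sum-init-last (t ∘ Fin.suc)) ⟩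
    t Fin.zero + (sum middle + t (Fin.suc (fromℕ n))) - (x ^ p + y ^ p)
      ≡⟨ cong₂ (λ a b → a + (sum middle + b) - (x ^ p + y ^ p)) first final ⟩
    y ^ p + (sum middle + x ^ p) - (x ^ p + y ^ p)
      ≡⟨ cancel (y ^ p) (sum middle) (x ^ p) ⟩
    sum middle
      ∎
    where
    open ≡-Reasoning
    cancel : ∀ a s b → a + (s + b) - (b + a) ≡ s
    cancel = solve-∀

fermat : ∀ {p} → Prime p → ∀ k → (+ k) ^ p ≡ + k mod + p
fermat {suc n} prime-p zero    = ≡⇒≡-mod (*-zeroˡ ((+ 0) ^ n))
fermat {p}     prime-p (suc k) = begin
  (+ 1 + + k) ^ p          ≈⟨ freshmans-dream prime-p (+ 1) (+ k) ⟩
  (+ 1) ^ p + (+ k) ^ p    ≈⟨ +-cong-mod (≡⇒≡-mod (^-zeroˡ p)) (fermat prime-p k) ⟩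
  + 1 + + k                ∎
  where open SetoidReasoning (mod-setoid (+ p))

-- Substituting x + k modulo p

VanishesBelow : ℤ → ℕ → Poly → Set
VanishesBelow m j α = ∀ i → i < j → coeff α i ≡ + 0 mod m

first-nonvanishing : ∀ m α e → ¬ coeff α e ≡ + 0 mod m →
  ∃[ j ] j ≤ e × ¬ coeff α j ≡ + 0 mod m × VanishesBelow m j α
first-nonvanishing m α e αₑ≢0 with ¬∀⟶∃¬-smallest (suc e) P (λ i → coeff α (toℕ i) ≡? + 0 mod m) ¬∀P
  where
  P : Fin (suc e) → Set
  P i = coeff α (toℕ i) ≡ + 0 mod m
  ¬∀P : ¬ (∀ i → P i)
  ¬∀P ∀P = αₑ≢0 (subst (λ j → coeff α j ≡ + 0 mod m) (toℕ-fromℕ e) (∀P (fromℕ e)))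
... | j , αⱼ≢0 , below = toℕ j , ℕ.≤-pred (toℕ<n j) , αⱼ≢0 , vanishes
  where
  vanishes : VanishesBelow m (toℕ j) α
  vanishes i i<j =
    subst (λ i → coeff α i ≡ + 0 mod m) (trans (toℕ-inject (fromℕ< i<j)) (toℕ-fromℕ< i<j)) (below (fromℕ< i<j))

module _ {m : ℤ} (a : ℤ) (α : Poly) where

  private
    T = affine (+ 1) a

  mulPow-translate-low : ∀ {j} → VanishesBelow m j α → ∀ n → VanishesBelow m j (mulPow T n α)
  mulPow-translate-low low zero    i       i<j = low i i<j
  mulPow-translate-low low (suc n) zero    i<j = begin
    coeff (T *ₚ P) 0  ≡⟨ coeff-affine*ₚ-zero (+ 1) a P ⟩
    a * coeff P 0     ≈⟨ *-congˡ-mod a (mulPow-translate-low low n 0 i<j) ⟩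
    a * + 0           ≡⟨ *-zeroʳ a ⟩
    + 0               ∎
    where
    open SetoidReasoning (mod-setoid m)
    P = mulPow T n α
  mulPow-translate-low low (suc n) (suc i) i<j = begin
    coeff (T *ₚ P) (suc i)
      ≡⟨ coeff-affine*ₚ-suc (+ 1) a P i ⟩
    a * coeff P (suc i) + + 1 * coeff P i
      ≈⟨ +-cong-mod (*-congˡ-mod a (mulPow-translate-low low n (suc i) i<j))
                    (*-congˡ-mod (+ 1) (mulPow-translate-low low n i (ℕ.<-trans (ℕ.n<1+n i) i<j))) ⟩
    a * + 0 + + 1 * + 0
      ≡⟨ cong (_+ + 0) (*-zeroʳ a) ⟩
    + 0
      ∎
    where
    open SetoidReasoning (mod-setoid m)
    P = mulPow T n α

  mulPow-translate-mid : ∀ {j} → VanishesBelow m j α → ∀ n → coeff (mulPow T n α) j ≡ a ^ n * coeff α j mod m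
  mulPow-translate-mid {j}     low zero    = ≡⇒≡-mod (sym (*-identityˡ (coeff α j)))
  mulPow-translate-mid {zero}  low (suc n) = begin
    coeff (T *ₚ P) 0         ≡⟨ coeff-affine*ₚ-zero (+ 1) a P ⟩
    a * coeff P 0            ≈⟨ *-congˡ-mod a (mulPow-translate-mid low n) ⟩
    a * (a ^ n * coeff α 0)  ≡⟨ sym (*-assoc a (a ^ n) (coeff α 0)) ⟩
    a * a ^ n * coeff α 0    ∎
    where
    open SetoidReasoning (mod-setoid m)
    P = mulPow T n α
  mulPow-translate-mid {suc j} low (suc n) = begin
    coeff (T *ₚ P) (suc j)
      ≡⟨ coeff-affine*ₚ-suc (+ 1) a P j ⟩
    a * coeff P (suc j) + + 1 * coeff P j
      ≈⟨ +-cong-mod (*-congˡ-mod a (mulPow-translate-mid low n)) (*-congˡ-mod (+ 1) (mulPow-translate-low low n j (ℕ.n<1+n j))) ⟩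
    a * (a ^ n * coeff α (suc j)) + + 1 * + 0
      ≡⟨ lemma a (a ^ n) (coeff α (suc j)) ⟩
    a * a ^ n * coeff α (suc j)
      ∎
    where
    open SetoidReasoning (mod-setoid m)
    P = mulPow T n α
    lemma : ∀ a aⁿ x → a * (aⁿ * x) + + 1 * + 0 ≡ a * aⁿ * x
    lemma = solve-∀

  -- (x + a)ⁿ⁺¹ = aⁿ⁺¹ + (n + 1) aⁿ x + x²(…), and below degree j the coefficients of α vanish modulo m.
  mulPow-translate-next : ∀ {j} → VanishesBelow m j α → ∀ n →
    coeff (mulPow T (suc n) α) (suc j) ≡ a ^ suc n * coeff α (suc j) + + suc n * a ^ n * coeff α j mod m
  mulPow-translate-next {j} low zero    =
    ≡⇒≡-mod (trans (coeff-affine*ₚ-suc (+ 1) a α j) (lemma a (coeff α (suc j)) (coeff α j)))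
    where
    lemma : ∀ a x y → a * x + + 1 * y ≡ a * + 1 * x + + 1 * + 1 * y
    lemma = solve-∀
  mulPow-translate-next {j} low (suc n) = begin
    coeff (T *ₚ P) (suc j)
      ≡⟨ coeff-affine*ₚ-suc (+ 1) a P j ⟩
    a * coeff P (suc j) + + 1 * coeff P j
      ≈⟨ +-cong-mod (*-congˡ-mod a (mulPow-translate-next low n)) (*-congˡ-mod (+ 1) (mulPow-translate-mid low (suc n))) ⟩
    a * (a ^ suc n * coeff α (suc j) + + suc n * a ^ n * coeff α j) + + 1 * (a ^ suc n * coeff α j)
      ≡⟨ lemma a (a ^ n) (coeff α (suc j)) (coeff α j) (+ suc n) ⟩
    a ^ suc (suc n) * coeff α (suc j) + + suc (suc n) * a ^ suc n * coeff α j
      ∎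
    where
    open SetoidReasoning (mod-setoid m)
    P = mulPow T (suc n) α
    lemma : ∀ a aⁿ x y s →
      a * (a * aⁿ * x + s * aⁿ * y) + + 1 * (a * aⁿ * y) ≡ a * (a * aⁿ) * x + (+ 1 + s) * (a * aⁿ) * y
    lemma = solve-∀

coeff-translate-shape : ∀ p a f q r → f ≈ₚ shape p q r → ∀ i →
  coeff (compose f (affine (+ 1) a)) i
    ≡ coeff (mulPow (affine (+ 1) a) p (compose q (affine (+ 1) a))) i
      - coeff (affine (+ 1) a *ₚ compose q (affine (+ 1) a)) i + + p * coeff (compose r (affine (+ 1) a)) i
coeff-translate-shape p a f q r f≈shape i =
  trans (compose-cong f (shape p q r) (affine (+ 1) a) f≈shape i) (coeff-compose-shape p q r (affine (+ 1) a) i)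

translate-shape-constant : ∀ {p} → Prime p → ∀ k f q r → f ≈ₚ shape p q r →
  coeff (compose f (affine (+ 1) (+ k))) 0 ≡ + 0 mod + p
translate-shape-constant {p} prime-p k f q r f≈shape = begin
  coeff (compose f T) 0
    ≡⟨ coeff-translate-shape p (+ k) f q r f≈shape 0 ⟩
  coeff (mulPow T p α) 0 - coeff (T *ₚ α) 0 + + p * coeff ρ 0
    ≈⟨ +-cong-mod (+-cong-mod (mulPow-translate-mid (+ k) α (λ _ ()) p) (-‿cong-mod (mulPow-translate-mid (+ k) α (λ _ ()) 1)))
                  (multiple≡0-mod (coeff ρ 0)) ⟩
  (+ k) ^ p * coeff α 0 - (+ k) ^ 1 * coeff α 0 + + 0
    ≈⟨ +-cong-mod (+-cong-mod (*-congʳ-mod (coeff α 0) (fermat prime-p k)) (≡⇒≡-mod refl)) (≡⇒≡-mod refl) ⟩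
  + k * coeff α 0 - (+ k) ^ 1 * coeff α 0 + + 0
    ≡⟨ lemma (+ k) (coeff α 0) ⟩
  + 0
    ∎
  where
  open SetoidReasoning (mod-setoid (+ p))
  T = affine (+ 1) (+ k)
  α = compose q T
  ρ = compose r T
  lemma : ∀ k x → k * x - k * + 1 * x + + 0 ≡ + 0
  lemma = solve-∀

translate-shape-next : ∀ {p} → Prime p → ∀ k f q r → f ≈ₚ shape p q r → ∀ {j} →
  VanishesBelow (+ p) j (compose q (affine (+ 1) (+ k))) →
  coeff (compose f (affine (+ 1) (+ k))) (suc j) ≡ - coeff (compose q (affine (+ 1) (+ k))) j mod + p
translate-shape-next {p@(suc n)} prime-p k f q r f≈shape {j} low = begin
  coeff (compose f T) (suc j)
    ≡⟨ coeff-translate-shape p (+ k) f q r f≈shape (suc j) ⟩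
  coeff (mulPow T p α) (suc j) - coeff (T *ₚ α) (suc j) + + p * coeff ρ (suc j)
    ≈⟨ +-cong-mod (+-cong-mod (mulPow-translate-next (+ k) α low n) (-‿cong-mod (mulPow-translate-next (+ k) α low 0)))
                  (multiple≡0-mod (coeff ρ (suc j))) ⟩
  (+ k) ^ p * α′ + + p * (+ k) ^ n * α₀ - ((+ k) ^ 1 * α′ + + 1 * (+ k) ^ 0 * α₀) + + 0
    ≈⟨ +-cong-mod (+-cong-mod (+-cong-mod (*-congʳ-mod α′ (fermat prime-p k))
                                          (≈-trans (≡⇒≡-mod (*-assoc (+ p) ((+ k) ^ n) α₀)) (multiple≡0-mod ((+ k) ^ n * α₀))))
                             (≡⇒≡-mod refl))
                  (≡⇒≡-mod refl) ⟩
  + k * α′ + + 0 - ((+ k) ^ 1 * α′ + + 1 * (+ k) ^ 0 * α₀) + + 0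
    ≡⟨ lemma (+ k) α′ α₀ ⟩
  - α₀
    ∎
  where
  open SetoidReasoning (mod-setoid (+ p))
  open Setoid (mod-setoid (+ p)) using () renaming (trans to ≈-trans)
  T = affine (+ 1) (+ k)
  α = compose q T
  ρ = compose r T
  α′ = coeff α (suc j)
  α₀ = coeff α j
  lemma : ∀ k x y → k * x + + 0 - (k * + 1 * x + + 1 * + 1 * y) + + 0 ≡ - y
  lemma = solve-∀

-- Contents

content-∣ : ∀ f i → content f ℕ.∣ ℤ.∣ coeff f i ∣
content-∣ []      i       = 0 ℕ.∣0
content-∣ (a ∷ f) zero    = gcd[m,n]∣m ℤ.∣ a ∣ (content f)
content-∣ (a ∷ f) (suc i) = ℕ.∣-trans (gcd[m,n]∣n ℤ.∣ a ∣ (content f)) (content-∣ f i)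

∣-content : ∀ {d} f → (∀ i → d ℕ.∣ ℤ.∣ coeff f i ∣) → d ℕ.∣ content f
∣-content {d} []      d∣f = d ℕ.∣0
∣-content     (a ∷ f) d∣f = gcd-greatest (d∣f 0) (∣-content f (d∣f ∘ suc))

content-cong : ∀ f g → f ≈ₚ g → content f ≡ content g
content-cong f g f≈g = ℕ.∣-antisym
  (∣-content g (λ i → subst (λ x → content f ℕ.∣ ℤ.∣ x ∣) (f≈g i) (content-∣ f i)))
  (∣-content f (λ i → subst (λ x → content g ℕ.∣ ℤ.∣ x ∣) (sym (f≈g i)) (content-∣ g i)))

content-·ₚ : ∀ c f → content (c ·ₚ f) ≡ ℤ.∣ c ∣ ℕ.* content f
content-·ₚ c []      = sym (ℕ.*-zeroʳ ℤ.∣ c ∣)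
content-·ₚ c (a ∷ f) = begin
  gcd ℤ.∣ c * a ∣ (content (c ·ₚ f))
    ≡⟨ cong₂ gcd (abs-* c a) (content-·ₚ c f) ⟩
  gcd (ℤ.∣ c ∣ ℕ.* ℤ.∣ a ∣) (ℤ.∣ c ∣ ℕ.* content f)
    ≡⟨ sym (c*gcd[m,n]≡gcd[cm,cn] ℤ.∣ c ∣ ℤ.∣ a ∣ (content f)) ⟩
  ℤ.∣ c ∣ ℕ.* gcd ℤ.∣ a ∣ (content f)
    ∎
  where open ≡-Reasoning

factor-·ₚ : ∀ d g → (∀ i → d ∣ coeff g i) → ∃[ h ] d ·ₚ h ≈ₚ g
factor-·ₚ d []      d∣g = [] , λ _ → refl
factor-·ₚ d (a ∷ g) d∣g with factor-·ₚ d g (d∣g ∘ suc) | d∣g 0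
... | h , d·h≈g | divides q a≡q*d = q ∷ h , λ where
  zero    → trans (*-comm d q) (sym a≡q*d)
  (suc i) → d·h≈g i

content-factor : ∀ d G → .{{ℤ.NonZero d}} → content G ≡ ℤ.∣ d ∣ → ∃[ h ] d ·ₚ h ≈ₚ G × Primitive h
content-factor d G content≡∣d∣ with factor-·ₚ d G d∣G
  where
  d∣G : ∀ i → d ∣ coeff G i
  d∣G i = ∣ᵤ⇒∣ (subst (ℕ._∣ ℤ.∣ coeff G i ∣) content≡∣d∣ (content-∣ G i))
... | h , d·h≈G = h , d·h≈G , ℕ.*-cancelˡ-≡ (content h) 1 ℤ.∣ d ∣ (begin
  ℤ.∣ d ∣ ℕ.* content h   ≡⟨ sym (content-·ₚ d h) ⟩
  content (d ·ₚ h)        ≡⟨ content-cong (d ·ₚ h) G d·h≈G ⟩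
  content G               ≡⟨ content≡∣d∣ ⟩
  ℤ.∣ d ∣                 ≡⟨ sym (ℕ.*-identityʳ _) ⟩
  ℤ.∣ d ∣ ℕ.* 1           ∎)
  where open ≡-Reasoning

primitive-translate : ∀ f a → Primitive f → Primitive (compose f (affine (+ 1) a))
primitive-translate f a primitive-f = ℕ.∣1⇒≡1 (subst (c ℕ.∣_) primitive-f (∣-content f c∣f))
  where
  π = compose f (affine (+ 1) a)
  c = content π
  c∣f : ∀ i → c ℕ.∣ ℤ.∣ coeff f i ∣
  c∣f i = ∣⇒∣ᵤ (subst (+ c ∣_) (compose-translate-inverse f a i)
                      (∣-compose π (affine (+ 1) (- a)) (λ j → ∣ᵤ⇒∣ (content-∣ π j)) i))

module _ {p : ℕ} where

  split-prime-power : 1 < p → ∀ n → n ≢ 0 → ∃[ m ] ∃[ c ] n ≡ p ℕ.^ m ℕ.* c × ¬ p ℕ.∣ c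
  split-prime-power 1<p n n≢0 = go n n≢0 (<-wellFounded n)
    where
    go : ∀ n → n ≢ 0 → Acc _<_ n → ∃[ m ] ∃[ c ] n ≡ p ℕ.^ m ℕ.* c × ¬ p ℕ.∣ c
    go n n≢0 (acc rec) with p ℕ.∣? n
    ... | no  p∤n                  = 0 , n , sym (ℕ.*-identityˡ n) , p∤n
    ... | yes (ℕ.divides q n≡q*p) with go q q≢0 (rec q<n)
      where
      q≢0 : q ≢ 0
      q≢0 refl = n≢0 n≡q*p
      q<n : q < n
      q<n = subst (q <_) (sym n≡q*p) (ℕ.m<m*n q p {{ℕ.≢-nonZero q≢0}} 1<p)
    ... | m , c , q≡pᵐc , p∤c = suc m , c , n≡pᵐ⁺¹c , p∤c
      where
      n≡pᵐ⁺¹c : n ≡ p ℕ.* p ℕ.^ m ℕ.* c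
      n≡pᵐ⁺¹c = begin
        n                       ≡⟨ n≡q*p ⟩
        q ℕ.* p                 ≡⟨ cong (ℕ._* p) q≡pᵐc ⟩
        p ℕ.^ m ℕ.* c ℕ.* p     ≡⟨ ℕ.*-comm (p ℕ.^ m ℕ.* c) p ⟩
        p ℕ.* (p ℕ.^ m ℕ.* c)   ≡⟨ sym (ℕ.*-assoc p (p ℕ.^ m) c) ⟩
        p ℕ.* p ℕ.^ m ℕ.* c     ∎
        where open ≡-Reasoning

  ∤⇒coprime : Prime p → ∀ {c} → ¬ p ℕ.∣ c → Coprime c p
  ∤⇒coprime prime-p p∤c (d∣c , d∣p) with prime⇒irreducible prime-p d∣p
  ... | inj₁ d≡1 = d≡1
  ... | inj₂ refl = contradiction d∣c p∤c

  coprime-∣-^* : ∀ {c} → Coprime c p → ∀ i y → c ℕ.∣ p ℕ.^ i ℕ.* y → c ℕ.∣ y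
  coprime-∣-^* {c} c⊥p zero    y c∣y = subst (c ℕ.∣_) (ℕ.*-identityˡ y) c∣y
  coprime-∣-^* {c} c⊥p (suc i) y c∣pⁱ⁺¹y =
    coprime-∣-^* c⊥p i y (coprime-divisor c⊥p (subst (c ℕ.∣_) (ℕ.*-assoc p (p ℕ.^ i) y) c∣pⁱ⁺¹y))

  ^∣^*⇒≤ : .{{ℕ.NonZero p}} → ∀ m a x → p ℕ.^ m ℕ.∣ p ℕ.^ a ℕ.* x → ¬ p ℕ.∣ x → m ≤ a
  ^∣^*⇒≤ zero    a       x _ _ = z≤n
  ^∣^*⇒≤ (suc m) zero    x pᵐ⁺¹∣x p∤x =
    contradiction (ℕ.∣-trans (ℕ.m∣m*n (p ℕ.^ m)) (subst (p ℕ.^ suc m ℕ.∣_) (ℕ.*-identityˡ x) pᵐ⁺¹∣x)) p∤x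
  ^∣^*⇒≤ (suc m) (suc a) x pᵐ⁺¹∣pᵃ⁺¹x p∤x =
    s≤s (^∣^*⇒≤ m a x (ℕ.*-cancelˡ-∣ p (subst (p ℕ.^ suc m ℕ.∣_) (ℕ.*-assoc p (p ℕ.^ a) x) pᵐ⁺¹∣pᵃ⁺¹x)) p∤x)

pos-^ : ∀ p i → (+ p) ^ i ≡ + (p ℕ.^ i)
pos-^ p zero    = refl
pos-^ p (suc i) = trans (cong (+ p *_) (pos-^ p i)) (sym (pos-* p (p ℕ.^ i)))

pos^-nonZero : ∀ p → .{{ℕ.NonZero p}} → ∀ n → ℤ.NonZero ((+ p) ^ n)
pos^-nonZero p n = subst ℕ.NonZero (cong ℤ.∣_∣ (sym (pos-^ p n))) (ℕ.m^n≢0 p n)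

-- The content of f(px + k)

module _ {p} (prime-p : Prime p) (G π : Poly) (G≡pⁱπ : ∀ i → coeff G i ≡ (+ p) ^ i * coeff π i) where

  private
    instance _ = prime⇒nonZero prime-p

    ∣G∣ : ∀ i → ℤ.∣ coeff G i ∣ ≡ p ℕ.^ i ℕ.* ℤ.∣ coeff π i ∣
    ∣G∣ i = trans (cong ℤ.∣_∣ (trans (G≡pⁱπ i) (cong (_* coeff π i) (pos-^ p i)))) (abs-* (+ (p ℕ.^ i)) (coeff π i))

    content∣pⁱπ : ∀ i → content G ℕ.∣ p ℕ.^ i ℕ.* ℤ.∣ coeff π i ∣
    content∣pⁱπ i = subst (content G ℕ.∣_) (∣G∣ i) (content-∣ G i)

  content-scaled-power : Primitive π → content G ≢ 0 → ∃[ m ] content G ≡ p ℕ.^ m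
  content-scaled-power primitive-π content≢0 with split-prime-power (prime⇒1<p prime-p) (content G) content≢0
  ... | m , c , content≡pᵐc , p∤c = m , trans content≡pᵐc (trans (cong (p ℕ.^ m ℕ.*_) c≡1) (ℕ.*-identityʳ _))
    where
    c∣π : ∀ i → c ℕ.∣ ℤ.∣ coeff π i ∣
    c∣π i = coprime-∣-^* (∤⇒coprime prime-p p∤c) i _ (ℕ.∣-trans c∣content (content∣pⁱπ i))
      where
      c∣content : c ℕ.∣ content G
      c∣content = subst (c ℕ.∣_) (sym content≡pᵐc) (ℕ.n∣m*n (p ℕ.^ m))
    c≡1 : c ≡ 1
    c≡1 = ℕ.∣1⇒≡1 (subst (c ℕ.∣_) primitive-π (∣-content π c∣π))

  content-scaled : Primitive π → + p ∣ coeff π 0 → ∀ s → ¬ + p ∣ coeff π s →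
    ∃[ ν ] content G ≡ p ℕ.^ suc ν × ν < s
  content-scaled primitive-π p∣π₀ s p∤πₛ with content-scaled-power primitive-π content≢0
    where
    content≢0 : content G ≢ 0
    content≢0 content≡0 = p∤πₛ (subst (+ p ∣_) (sym (∣i∣≡0⇒i≡0 ∣πₛ∣≡0)) (divides (+ 0) refl))
      where
      ∣πₛ∣≡0 : ℤ.∣ coeff π s ∣ ≡ 0
      ∣πₛ∣≡0 = ℕ.*-cancelˡ-≡ _ 0 (p ℕ.^ s) {{ℕ.m^n≢0 p s}}
        (trans (ℕ.0∣⇒≡0 (subst (ℕ._∣ _) content≡0 (content∣pⁱπ s))) (sym (ℕ.*-zeroʳ (p ℕ.^ s))))
  ... | zero  , content≡1    = contradiction (ℕ.∣1⇒≡1 (subst (p ℕ.∣_) content≡1 p∣content))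
                                            (ℕ.>⇒≢ (prime⇒1<p prime-p))
    where
    p∣content : p ℕ.∣ content G
    p∣content = ∣-content G λ where
      zero    → subst (p ℕ.∣_) (trans (sym (ℕ.*-identityˡ _)) (sym (∣G∣ 0))) (∣⇒∣ᵤ p∣π₀)
      (suc i) → subst (p ℕ.∣_) (sym (∣G∣ (suc i))) (ℕ.∣m⇒∣m*n _ (ℕ.m∣m*n (p ℕ.^ i)))
  ... | suc ν , content≡pᵛ⁺¹ =
    ν , content≡pᵛ⁺¹ ,
    ^∣^*⇒≤ (suc ν) s ℤ.∣ coeff π s ∣ (subst (ℕ._∣ _) content≡pᵛ⁺¹ (content∣pⁱπ s)) (p∤πₛ ∘ ∣ᵤ⇒∣)

∣-coeff-beyond : ∀ p → .{{ℕ.NonZero p}} → ∀ ν fk G π →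
  (+ p) ^ suc ν ·ₚ fk ≈ₚ G → (∀ i → coeff G i ≡ (+ p) ^ i * coeff π i) → ∀ i → suc ν < i → + p ∣ coeff fk i
∣-coeff-beyond p ν fk G π d·fk≈G G≡pⁱπ i ν<i with ℕ.m≤n⇒∃[o]m+o≡n ν<i
... | k , refl = divides ((+ p) ^ k * coeff π i) (trans fkᵢ≡ (*-comm (+ p) _))
  where
  d = (+ p) ^ suc ν
  fkᵢ≡ : coeff fk i ≡ + p * ((+ p) ^ k * coeff π i)
  fkᵢ≡ = *-cancelˡ-≡ d _ _ {{pos^-nonZero p (suc ν)}} (begin
    d * coeff fk i                          ≡⟨ sym (coeff-·ₚ d fk i) ⟩
    coeff (d ·ₚ fk) i                       ≡⟨ d·fk≈G i ⟩
    coeff G i                               ≡⟨ G≡pⁱπ i ⟩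
    (+ p) ^ i * coeff π i                   ≡⟨ cong (λ n → (+ p) ^ n * coeff π i) (cong suc (sym (ℕ.+-suc ν k))) ⟩
    (+ p) ^ (suc ν ℕ.+ suc k) * coeff π i   ≡⟨ cong (_* coeff π i) (^-distribˡ-+-* (+ p) (suc ν) (suc k)) ⟩
    d * (+ p) ^ suc k * coeff π i           ≡⟨ *-assoc d _ _ ⟩
    d * (+ p * (+ p) ^ k * coeff π i)       ≡⟨ cong (d *_) (*-assoc (+ p) _ _) ⟩
    d * (+ p * ((+ p) ^ k * coeff π i))     ∎)
    where open ≡-Reasoning

digit-∤ : ∀ {p x} → + 0 ℤ.≤ x → x ℤ.< + p → x ≢ + 0 → ¬ + p ∣ x
digit-∤ {x = + zero}  _ _            x≢0 _   = x≢0 refl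
digit-∤ {x = + suc m} _ (ℤ.+<+ m<p) _   p∣x = ℕ.<⇒≱ m<p (ℕ.∣⇒≤ (∣⇒∣ᵤ p∣x))

leading-digit-∤ : ∀ {p e} q → DigitPoly p e q → ¬ + p ∣ coeff q e
leading-digit-∤ {e = e} q (digits , qₑ≢0 , _) = digit-∤ (proj₁ (digits e)) (proj₂ (digits e)) qₑ≢0

shape-digit-degree : ∀ {p} → 1 < p → ∀ n e q r g → DigitPoly p e q → g ≈ₚ shape p q r →
  (∀ i → n < i → + p ∣ coeff g i) → e ℕ.+ p ≤ n
shape-digit-degree {p@(suc (suc p′))} (s≤s (s≤s z≤n)) n e q r g digit-q@(_ , _ , deg-q) g≈shape p∣g =
  ℕ.≮⇒≥ λ n<e+p → leading-digit-∤ q digit-q (p∣qₑ (p∣g (p ℕ.+ e) (subst (n <_) (ℕ.+-comm e p) n<e+p)))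
  where
  gₚ₊ₑ≡ : coeff g (p ℕ.+ e) ≡ coeff q e - + 0 + + p * coeff r (p ℕ.+ e)
  gₚ₊ₑ≡ = begin
    coeff g (p ℕ.+ e)
      ≡⟨ trans (g≈shape (p ℕ.+ e)) (coeff-shape p q r (p ℕ.+ e)) ⟩
    coeff (X ^ₚ p *ₚ q) (p ℕ.+ e) - coeff (X *ₚ q) (p ℕ.+ e) + + p * coeff r (p ℕ.+ e)
      ≡⟨ cong₂ (λ x y → x - y + + p * coeff r (p ℕ.+ e))
               (coeff-X^*ₚ p q e) (trans (X*ₚ q (p ℕ.+ e)) (deg-q (suc p′ ℕ.+ e) (ℕ.m<n+m e (s≤s z≤n)))) ⟩
    coeff q e - + 0 + + p * coeff r (p ℕ.+ e)
      ∎
    where open ≡-Reasoning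
  p∣qₑ : + p ∣ coeff g (p ℕ.+ e) → + p ∣ coeff q e
  p∣qₑ p∣gₚ₊ₑ =
    subst (+ p ∣_) (+-identityʳ _) (∣m+n∣n⇒∣m (subst (+ p ∣_) gₚ₊ₑ≡ p∣gₚ₊ₑ) (∣m⇒∣m*n (coeff r (p ℕ.+ e)) ∣-refl))

module _ {p} (prime-p : Prime p) (f q r : Poly) (f≈shape : f ≈ₚ shape p q r) (k : ℕ) where

  private
    instance _ = prime⇒nonZero prime-p
    T = affine (+ 1) (+ k)
    π = compose f T
    α = compose q T
    G = compose f ((+ p) ·ₚ X +ₚ const (+ k))

    G≡pⁱπ : ∀ i → coeff G i ≡ (+ p) ^ i * coeff π i
    G≡pⁱπ i =
      trans (compose-congʳ f ((+ p) ·ₚ X +ₚ const (+ k)) (affine (+ p) (+ k)) L≈ i) (coeff-compose-scale f (+ p) (+ k) i)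
      where
      L≈ : (+ p) ·ₚ X +ₚ const (+ k) ≈ₚ affine (+ p) (+ k)
      L≈ zero          = trans (cong (_+ + k) (*-zeroʳ (+ p))) (+-identityˡ (+ k))
      L≈ (suc zero)    = *-identityʳ (+ p)
      L≈ (suc (suc i)) = refl

    αₑ≢0 : ∀ {e} → DigitPoly p e q → ¬ coeff α e ≡ + 0 mod + p
    αₑ≢0 {e} digit-q@(_ , _ , deg-q) αₑ≡0 = leading-digit-∤ q digit-q (subst (+ p ∣_) αₑ≡qₑ (≡0-mod⇒∣ αₑ≡0))
      where
      αₑ≡qₑ : coeff α e ≡ coeff q e
      αₑ≡qₑ = begin
        coeff α e              ≡⟨ coeff-compose-affine-top q (+ 1) (+ k) e deg-q ⟩
        (+ 1) ^ e * coeff q e  ≡⟨ cong (_* coeff q e) (^-zeroˡ e) ⟩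
        + 1 * coeff q e        ≡⟨ *-identityˡ _ ⟩
        coeff q e              ∎
        where open ≡-Reasoning

    p∣π₀ : + p ∣ coeff π 0
    p∣π₀ = ≡0-mod⇒∣ (translate-shape-constant prime-p k f q r f≈shape)

    p∤πⱼ₊₁ : ∀ {j} → ¬ coeff α j ≡ + 0 mod + p → VanishesBelow (+ p) j α → ¬ + p ∣ coeff π (suc j)
    p∤πⱼ₊₁ {j} αⱼ≢0 below p∣πⱼ₊₁ = αⱼ≢0 (begin
      coeff α j              ≡⟨ sym (neg-involutive (coeff α j)) ⟩
      - - coeff α j          ≈⟨ -‿cong-mod (sym-mod (translate-shape-next prime-p k f q r f≈shape below)) ⟩
      - coeff π (suc j)      ≈⟨ -‿cong-mod (∣⇒≡0-mod p∣πⱼ₊₁) ⟩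
      + 0                    ∎)
      where
      open SetoidReasoning (mod-setoid (+ p))
      open Setoid (mod-setoid (+ p)) using () renaming (sym to sym-mod)

  scaled-translate-content : Primitive f → ∀ {e} → DigitPoly p e q → ∃[ ν ] ν ≤ e × content G ≡ p ℕ.^ suc ν
  scaled-translate-content primitive-f {e} digit-q =
    let j , j≤e , αⱼ≢0 , below = first-nonvanishing (+ p) α e (αₑ≢0 digit-q)
        ν , content≡pᵛ⁺¹ , ν<j+1 =
          content-scaled prime-p G π G≡pⁱπ (primitive-translate f (+ k) primitive-f) p∣π₀ (suc j) (p∤πⱼ₊₁ αⱼ≢0 below)
    in ν , ℕ.≤-trans (ℕ.≤-pred ν<j+1) j≤e , content≡pᵛ⁺¹

  scaled-translate-divisible : ∀ ν fk → (+ p) ^ suc ν ·ₚ fk ≈ₚ G → ∀ i → suc ν < i → + p ∣ coeff fk i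
  scaled-translate-divisible ν fk pᵛ⁺¹fk≈G = ∣-coeff-beyond p ν fk G π pᵛ⁺¹fk≈G G≡pⁱπ

lemma4 : (p : ℕ) → Prime p → (f : Poly) → Primitive f →
         (e : ℕ) (q r : Poly) → DigitPoly p e q → f ≈ₚ shape p q r →
         (k : ℕ) → k < p →
         ∃[ ν ] ∃[ fk ]
           ( ν ≤ e
           × ((+ p) ^ (suc ν)) ·ₚ fk ≈ₚ compose f ((+ p) ·ₚ X +ₚ const (+ k))
           × Primitive fk
           × (FixedPrimeDivisor p fk →
                (ek : ℕ) (qk rk : Poly) → DigitPoly p ek qk → fk ≈ₚ shape p qk rk →
                (p ≤ suc e) × (ek ℕ.+ p ≤ suc e)))
lemma4 p prime-p f primitive-f e q r digit-q f≈shape k _ =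
  let ν , ν≤e , content≡pᵛ⁺¹ = scaled-translate-content prime-p f q r f≈shape k primitive-f digit-q
      fk , pᵛ⁺¹fk≈G , primitive-fk =
        content-factor ((+ p) ^ suc ν) (compose f ((+ p) ·ₚ X +ₚ const (+ k))) {{pos^-nonZero p {{prime⇒nonZero prime-p}} (suc ν)}}
          (trans content≡pᵛ⁺¹ (cong ℤ.∣_∣ (sym (pos-^ p (suc ν)))))
      degree-bound : ∀ ek qk rk → DigitPoly p ek qk → fk ≈ₚ shape p qk rk → ek ℕ.+ p ≤ suc e
      degree-bound ek qk rk digit-qk fk≈shape = ℕ.≤-trans
        (shape-digit-degree (prime⇒1<p prime-p) (suc ν) ek qk rk fk digit-qk fk≈shape
          (scaled-translate-divisible prime-p f q r f≈shape k ν fk pᵛ⁺¹fk≈G))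
        (s≤s ν≤e)
  in ν , fk , ν≤e , pᵛ⁺¹fk≈G , primitive-fk , λ _ ek qk rk digit-qk fk≈shape →
       ℕ.≤-trans (ℕ.m≤n+m p ek) (degree-bound ek qk rk digit-qk fk≈shape) , degree-bound ek qk rk digit-qk fk≈shape
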